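{- Let $q\ge 2$ and $m\ge 1$. Every fractal matrix obtained from $M_{q,m}$ by permuting rows and columns is non-expandable: no bang of it has more columns than it has.
   Context: Fractal matrices: $M_{q,0}$ is the $1\times 0$ matrix; for $l\ge1$, $M_{q,l}$ is the $q^l\times\frac{q^l-1}{q-1}$ matrix over ${\bf Z}_q\cup\{*\}$ whose rows are split into $q$ consecutive blocks $B_0,\dots,B_{q-1}$ of $q^{l-1}$ rows, whose first column equals $a$ on every row of $B_a$, and whose remaining columns are split into $q$ consecutive groups $G_0,\dots,G_{q-1}$ of $\frac{q^{l-1}-1}{q-1}$ columns each, where the submatrix on $B_a\times G_a$ is $M_{q,l-1}$ and on $B_a\times G_b$, $b\ne a$, consists only of $*$. Such a matrix is the star matrix (rows = star patterns, with fixed coordinate values and $*$ at free coordinates) of an A-primitive partition of ${\bf Z}_q^{(q^m-1)/(q-1)}$ into $q^m$ subcubes of equal dimension, A-primitive meaning no column consists only of $*$. Bang: given such a star matrix $M$, a column $i$ and $a\in{\bf Z}_q$, the bang of $M$ is obtained by: (1) deleting column $i$; (2) deleting every row whose entry in column $i$ was a number different from $a$; (3) replacing each row whose entry in column $i$ was $a$ by $q$ identical copies; (4) for each such group of $q$ copies, adding a new column having $*$ outside the group and containing each element of ${\bf Z}_q$ exactly once within the group; (5) deleting all columns consisting only of $*$. $M$ is expandable if for some column $i$ and some $a$ the bang has more columns than $M$, and non-expandable otherwise. -}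

module Defs where

open import Data.Nat using (ℕ; zero; suc; _*_; _<_)
open import Data.Fin using (Fin; zero; suc)
open import Data.Fin.Properties using (_≟_)
open import Data.Fin.Permutation using (Permutation′; _⟨$⟩ʳ_)
open import Data.Bool using (Bool; true; false; if_then_else_)
open import Data.Maybe using (Maybe; just; nothing; is-just; is-nothing)
open import Data.Maybe.Properties using (≡-dec)
open import Data.List as L using (List; []; _∷_; filterᵇ; allFin; concatMap; length)
open import Data.List.Relation.Binary.Permutation.Propositional using (_↭_)
open import Data.Bool.ListAction using (any)
open import Data.Vec as V using (Vec; removeAt; lookup; tabulate; _++_; replicate; fromList)
open import Data.Product using (Σ; ∃; ∃-syntax; _,_; proj₁)
open import Relation.Nullary using (does)

-- An entry of a star matrix: a number of Z_q (just a) or a star * (nothing).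
Entry : ℕ → Set
Entry q = Maybe (Fin q)

Rows : ℕ → ℕ → Set
Rows q c = List (Vec (Entry q) c)

-- Number of columns of the fractal matrix M_{q,l}: (q^l - 1)/(q - 1).
fracCols : ℕ → ℕ → ℕ
fracCols q zero    = 0
fracCols q (suc l) = suc (q * fracCols q l)

-- Rows of M_{q,l}, in order (blocks B_0, ..., B_{q-1}).
fractal : (q l : ℕ) → Rows q (fracCols q l)
fractal q zero    = V.[] ∷ []
fractal q (suc l) =
  concatMap (λ a → L.map (λ r → just a V.∷ V.concat (tabulate (λ b →
      if does (b ≟ a) then r else replicate (fracCols q l) nothing)))
    (fractal q l))
  (allFin q)

deleteStarCols : ∀ {q c} → Rows q c → Σ ℕ (Rows q)
deleteStarCols {q} {c} rs =
  let keep = filterᵇ (λ t → any (λ r → is-just (lookup r t)) rs) (allFin c)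
      kv   = fromList keep
  in length keep , L.map (λ r → tabulate (λ s → lookup r (lookup kv s))) rs

bang : ∀ {q c} → Rows q c → Fin c → Fin q → Σ ℕ (Rows q)
bang {q} {suc n} rs i a =
  let isA    = λ (r : Vec (Entry q) (suc n)) → does (≡-dec _≟_ (lookup r i) (just a))
      aRows  = filterᵇ isA rs
      sRows  = filterᵇ (λ r → is-nothing (lookup r i)) rs
      k      = length aRows
      av     = fromList aRows
      starPart = L.map (λ r → removeAt r i ++ replicate k nothing) sRows
      copyPart = concatMap (λ j → L.map (λ b →
                   removeAt (lookup av j) i ++
                   tabulate (λ t → if does (t ≟ j) then just b else nothing))
                 (allFin q)) (allFin k)
  in deleteStarCols {q} {n Data.Nat.+ k} (starPart L.++ copyPart)

bangCols : ∀ {q c} → Rows q c → Fin c → Fin q → ℕ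
bangCols rs i a = proj₁ (bang rs i a)

Expandable : ∀ {q c} → Rows q c → Set
Expandable {q} {c} rs = ∃[ i ] ∃[ a ] (c < bangCols rs i a)

permCols : ∀ {q c} → Permutation′ c → Vec (Entry q) c → Vec (Entry q) c
permCols σ r = tabulate (λ j → lookup r (σ ⟨$⟩ʳ j))

PermutedFractal : (q m : ℕ) → Rows q (fracCols q m) → Set
PermutedFractal q m rs =
  ∃[ σ ] (rs ↭ L.map (permCols {q} σ) (fractal q m))

{-# OPTIONS --safe #-}
module Submission where

-- For a column i and a ∈ Z_q, call a column t ≠ i touched if some row with a or * in column i
-- has a number in column t, and let K be the number of rows with a in column i. The bang at
-- (i, a) keeps only touched columns and adds K new ones, so it has at most #touched + K columns,
-- and this bound is invariant under permuting rows and columns. For M_{q,l} it is at most the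
-- number (q^l - 1)/(q - 1) of columns, by induction on l. At the first column only the block B_a
-- survives: it touches the f = (q^(l-1) - 1)/(q - 1) columns of G_a, and K = q^(l-1). At a
-- column p of a group G_b only the rows of B_b have numbers, so the touched columns inside G_b
-- and K are those of M_{q,l-1} at p, while column 0 adds at most 1 and each other group at most f.

open import Defs
open import Data.Nat using (ℕ; zero; suc; _+_; _*_; _^_; _≤_; z≤n; s≤s)
open import Relation.Nullary using (¬_; does; yes; no)

open import Data.Bool using (Bool; true; false; T; not; _∧_; if_then_else_)
open import Data.Bool.Properties using (T-∧)
open import Data.Bool.ListAction using (any)
open import Data.Empty using (⊥-elim)
open import Data.Fin using (Fin; zero; suc; punchIn; _↑ˡ_; _↑ʳ_; combine; remQuot)
open import Data.Fin.Permutation using (Permutation′; _⟨$⟩ʳ_)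
open import Data.Fin.Properties using (_≟_; punchInᵢ≢i; punchOut-punchIn; combine-remQuot)
open import Data.List as L using (List; []; _∷_; _++_; filterᵇ; allFin; concatMap; length)
open import Data.List.Membership.Propositional using (_∈_; find; lose)
open import Data.List.Membership.Propositional.Properties
  using (∈-map⁻; ∈-++⁻; ∈-concatMap⁻; ∈-filter⁻)
open import Data.List.Properties using (length-++; length-map; filter-++; length-filter)
open import Data.List.Relation.Binary.Permutation.Propositional using (_↭_)
open import Data.List.Relation.Binary.Permutation.Propositional.Properties
  using (↭-length; filter-↭; ∈-resp-↭)
open import Data.List.Relation.Unary.Any.Properties using (any⁺; any⁻)
open import Data.Maybe using (just; nothing; is-just; is-nothing)
open import Data.Maybe.Properties using (≡-dec)
open import Data.Nat.Properties
  using (≤-refl; ≤-trans; ≤-reflexive; +-mono-≤; +-monoˡ-≤; m≤n+m; n≤0⇒n≡0; <⇒≱;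
         +-assoc; +-identityʳ; *-zeroʳ; *-distribˡ-+;
         +-0-commutativeMonoid; +-commutativeSemigroup; module ≤-Reasoning)
open import Algebra.Properties.CommutativeMonoid.Sum +-0-commutativeMonoid
  using (sum; sum-cong-≗; sum-remove; sum-permute; sum-replicate-zero)
open import Algebra.Properties.CommutativeSemigroup +-commutativeSemigroup using (xy∙z≈xz∙y)
open import Data.Product using (∃-syntax; ∃₂; _×_; _,_; proj₁; proj₂)
open import Data.Sum using (inj₁; inj₂)
open import Data.Vec as V using (Vec; lookup; removeAt; replicate; tabulate)
open import Data.Vec.Properties
  using (lookup∘tabulate; lookup-concat; lookup-replicate; lookup-++ˡ; removeAt-punchOut)
open import Data.Vec.Membership.Propositional.Properties using (∈-lookup; ∈-fromList⁻)
open import Function using (_∘_; id; Equivalence)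
open import Function.Bundles using (Injection)
open import Function.Properties.Inverse using (↔⇒↣)
open import Relation.Binary.PropositionalEquality
  using (_≡_; _≢_; refl; sym; trans; cong; subst; module ≡-Reasoning)
open import Relation.Nullary.Decidable using (dec-true; dec-false; T?)

private
  variable
    A B : Set
    c n q : ℕ

indicator : Bool → ℕ
indicator false = 0
indicator true  = 1

card : (Fin n → Bool) → ℕ
card p = sum (indicator ∘ p)

count : (A → Bool) → List A → ℕ
count p xs = length (filterᵇ p xs)

sum-const : ∀ n m → sum {n} (λ _ → m) ≡ n * m
sum-const zero    m = refl
sum-const (suc n) m = cong (m +_) (sum-const n m)

sum-≤-* : ∀ {m} (g : Fin n → ℕ) → (∀ t → g t ≤ m) → sum g ≤ n * m
sum-≤-* {zero}  g g≤m = z≤n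
sum-≤-* {suc n} g g≤m = +-mono-≤ (g≤m zero) (sum-≤-* (g ∘ suc) (g≤m ∘ suc))

sum-concentrated : (g : Fin (suc n) → ℕ) (b : Fin (suc n)) →
                   (∀ b′ → b′ ≢ b → g b′ ≡ 0) → sum g ≡ g b
sum-concentrated {n} g b g≡0 = begin
  sum g                      ≡⟨ sum-remove {i = b} g ⟩
  g b + sum (g ∘ punchIn b)  ≡⟨ cong (g b +_) (sum-cong-≗ (λ j → g≡0 _ (punchInᵢ≢i b j))) ⟩
  g b + sum {n} (λ _ → 0)    ≡⟨ cong (g b +_) (sum-replicate-zero n) ⟩
  g b + 0                    ≡⟨ +-identityʳ (g b) ⟩
  g b                        ∎
  where open ≡-Reasoning

sum-splitAt : ∀ m (g : Fin (m + n) → ℕ) → sum g ≡ sum (g ∘ (_↑ˡ n)) + sum (g ∘ (m ↑ʳ_))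
sum-splitAt zero    g = refl
sum-splitAt (suc m) g =
  trans (cong (g zero +_) (sum-splitAt m (g ∘ suc))) (sym (+-assoc (g zero) _ _))

sum-combine : ∀ m (g : Fin (m * n) → ℕ) → sum g ≡ sum {m} (λ b → sum {n} (g ∘ combine b))
sum-combine zero        g = refl
sum-combine {n} (suc m) g =
  trans (sum-splitAt n g) (cong (sum (g ∘ (_↑ˡ (m * n))) +_) (sum-combine m (g ∘ (n ↑ʳ_))))

indicator≤1 : ∀ b → indicator b ≤ 1
indicator≤1 false = z≤n
indicator≤1 true  = ≤-refl

indicator-mono : ∀ {b b′} → (T b → T b′) → indicator b ≤ indicator b′
indicator-mono {false}        _    = z≤n
indicator-mono {true} {true}  _    = ≤-refl
indicator-mono {true} {false} b⇒b′ = ⊥-elim (b⇒b′ _)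

card-≤ : (p : Fin n → Bool) → card p ≤ n
card-≤ {zero}  p = z≤n
card-≤ {suc n} p = +-mono-≤ (indicator≤1 (p zero)) (card-≤ (p ∘ suc))

card-mono : (p p′ : Fin n → Bool) → (∀ t → T (p t) → T (p′ t)) → card p ≤ card p′
card-mono {zero}  p p′ p⇒p′ = z≤n
card-mono {suc n} p p′ p⇒p′ =
  +-mono-≤ (indicator-mono (p⇒p′ zero)) (card-mono (p ∘ suc) (p′ ∘ suc) (p⇒p′ ∘ suc))

card-none : (p : Fin n → Bool) → (∀ t → ¬ T (p t)) → card p ≡ 0
card-none {n} p none =
  n≤0⇒n≡0 (≤-trans (card-mono p (λ _ → false) none) (≤-reflexive (sum-replicate-zero n)))

card-punchIn-≤ : (p : Fin (suc n) → Bool) (i : Fin (suc n)) → card (p ∘ punchIn i) ≤ card p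
card-punchIn-≤ p i =
  ≤-trans (m≤n+m _ (indicator (p i))) (≤-reflexive (sym (sum-remove {i = i} (indicator ∘ p))))

count-++ : (p : A → Bool) (xs ys : List A) → count p (xs ++ ys) ≡ count p xs + count p ys
count-++ p xs ys = trans (cong length (filter-++ (T? ∘ p) xs ys)) (length-++ (filterᵇ p xs))

count-tabulate : (p : A → Bool) (h : Fin n → A) → count p (L.tabulate h) ≡ card (p ∘ h)
count-tabulate {n = zero}  p h = refl
count-tabulate {n = suc n} p h with p (h zero)
... | true  = cong suc (count-tabulate p (h ∘ suc))
... | false = count-tabulate p (h ∘ suc)

count-concatMap-tabulate : (p : B → Bool) (g : A → List B) (h : Fin n → A) →
  count p (concatMap g (L.tabulate h)) ≡ sum (λ b → count p (g (h b)))
count-concatMap-tabulate {n = zero}  p g h = refl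
count-concatMap-tabulate {n = suc n} p g h =
  trans (count-++ p (g (h zero)) _)
        (cong (count p (g (h zero)) +_) (count-concatMap-tabulate p g (h ∘ suc)))

length-concatMap-tabulate : (g : A → List B) (h : Fin n → A) →
  length (concatMap g (L.tabulate h)) ≡ sum (λ b → length (g (h b)))
length-concatMap-tabulate {n = zero}  g h = refl
length-concatMap-tabulate {n = suc n} g h =
  trans (length-++ (g (h zero)))
        (cong (length (g (h zero)) +_) (length-concatMap-tabulate g (h ∘ suc)))

count-map : (p : B → Bool) (f : A → B) (xs : List A) → count p (L.map f xs) ≡ count (p ∘ f) xs
count-map p f []       = refl
count-map p f (x ∷ xs) with p (f x)
... | true  = cong suc (count-map p f xs)
... | false = count-map p f xs

count-cong : {p p′ : A → Bool} → (∀ x → p x ≡ p′ x) → (xs : List A) → count p xs ≡ count p′ xs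
count-cong p≗p′ []       = refl
count-cong {p′ = p′} p≗p′ (x ∷ xs) rewrite p≗p′ x with p′ x
... | true  = cong suc (count-cong p≗p′ xs)
... | false = count-cong p≗p′ xs

count-none : {p : A → Bool} → (∀ x → p x ≡ false) → (xs : List A) → count p xs ≡ 0
count-none none []       = refl
count-none none (x ∷ xs) rewrite none x = count-none none xs

count-↭ : (p : A → Bool) {xs ys : List A} → xs ↭ ys → count p xs ≡ count p ys
count-↭ p xs↭ys = ↭-length (filter-↭ (T? ∘ p) xs↭ys)

carries : Fin q → Entry q → Bool
carries a e = does (≡-dec _≟_ e (just a))

survives : Fin q → Entry q → Bool
survives a nothing  = true
survives a (just b) = does (b ≟ a)

is-nothing⇒survives : ∀ {a : Fin q} e → T (is-nothing e) → T (survives a e)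
is-nothing⇒survives nothing _ = _

carries⇒survives : ∀ {a : Fin q} e → T (carries a e) → T (survives a e)
carries⇒survives nothing  _   = _
carries⇒survives (just b) b≡a = b≡a

survives-just⇒≡ : ∀ {a b : Fin q} → T (survives a (just b)) → b ≡ a
survives-just⇒≡ {a = a} {b} s with b ≟ a
... | yes b≡a = b≡a

occurrences : Rows q c → Fin c → Fin q → ℕ
occurrences rs i a = count (λ r → carries a (lookup r i)) rs

Covered : Rows q c → Fin c → Fin q → Fin c → Set
Covered rs i a t = ∃[ r ] r ∈ rs × T (survives a (lookup r i)) × T (is-just (lookup r t))

touches : Rows q c → Fin c → Fin q → Fin c → Bool
touches rs i a t =
  not (does (i ≟ t)) ∧ any (λ r → survives a (lookup r i) ∧ is-just (lookup r t)) rs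

bangBound : Rows q c → Fin c → Fin q → ℕ
bangBound rs i a = card (touches rs i a) + occurrences rs i a

touches⁺ : {rs : Rows q c} {i t : Fin c} {a : Fin q} →
           i ≢ t → Covered rs i a t → T (touches rs i a t)
touches⁺ {i = i} {t} i≢t (r , r∈rs , s , j) with i ≟ t
... | yes i≡t = i≢t i≡t
... | no _    = any⁺ _ (lose r∈rs (Equivalence.from T-∧ (s , j)))

touches⁻ : {rs : Rows q c} {i t : Fin c} {a : Fin q} →
           T (touches rs i a t) → i ≢ t × Covered rs i a t
touches⁻ {rs = rs} {i} {t} h with i ≟ t
... | no i≢t with find (any⁻ _ rs h)
...   | r , r∈rs , sj = i≢t , r , r∈rs , Equivalence.to T-∧ sj

lookup-removeAt : (xs : Vec A (suc n)) (i : Fin (suc n)) (j : Fin n) →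
                  lookup (removeAt xs i) j ≡ lookup xs (punchIn i j)
lookup-removeAt xs i j =
  trans (cong (lookup (removeAt xs i)) (sym (punchOut-punchIn i))) (removeAt-punchOut xs _)

bangCols≤bangBound : (rs : Rows q c) (i : Fin c) (a : Fin q) → bangCols rs i a ≤ bangBound rs i a
bangCols≤bangBound {q} {suc n} rs i a = begin
  bangCols rs i a                                ≡⟨ count-tabulate kept id ⟩
  card kept                                      ≡⟨ sum-splitAt n (indicator ∘ kept) ⟩
  card (kept ∘ (_↑ˡ k)) + card (kept ∘ (n ↑ʳ_))  ≤⟨ +-mono-≤ (card-mono _ _ oldKept) (card-≤ _) ⟩
  card (touches rs i a ∘ punchIn i) + k
    ≤⟨ +-monoˡ-≤ k (card-punchIn-≤ (touches rs i a) i) ⟩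
  card (touches rs i a) + k                      ∎
  where
  open ≤-Reasoning
  -- The local definitions of bang, repeated so that bangCols rs i a unfolds to
  -- count kept (allFin (n + k)).
  isA      = λ (r : Vec (Entry q) (suc n)) → does (≡-dec _≟_ (lookup r i) (just a))
  aRows    = filterᵇ isA rs
  sRows    = filterᵇ (λ r → is-nothing (lookup r i)) rs
  k        = length aRows
  av       = V.fromList aRows
  starPart = L.map (λ r → removeAt r i V.++ replicate k nothing) sRows
  copyPart = concatMap (λ j → L.map (λ b →
               removeAt (lookup av j) i V.++
               tabulate (λ t → if does (t ≟ j) then just b else nothing))
             (allFin q)) (allFin k)

  kept : Fin (n + k) → Bool
  kept t = any (λ r → is-just (lookup r t)) (starPart ++ copyPart)

  origin : ∀ {ρ} → ρ ∈ starPart ++ copyPart →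
           ∃₂ λ r w → r ∈ rs × T (survives a (lookup r i)) × ρ ≡ removeAt r i V.++ w
  origin ρ∈ with ∈-++⁻ starPart ρ∈
  ... | inj₁ ρ∈star with ∈-map⁻ _ ρ∈star
  ...   | r , r∈sRows , refl with ∈-filter⁻ (T? ∘ (λ r → is-nothing (lookup r i))) r∈sRows
  ...     | r∈rs , star = r , _ , r∈rs , is-nothing⇒survives (lookup r i) star , refl
  origin ρ∈ | inj₂ ρ∈copy with find (∈-concatMap⁻ _ {xs = allFin k} ρ∈copy)
  ... | j , _ , ρ∈copies with ∈-map⁻ _ ρ∈copies
  ...   | b , _ , refl with ∈-filter⁻ (T? ∘ isA) (∈-fromList⁻ (∈-lookup j av))
  ...     | r∈rs , hit =
    lookup av j , _ , r∈rs , carries⇒survives (lookup (lookup av j) i) hit , refl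

  oldKept : ∀ j → T (kept (j ↑ˡ k)) → T (touches rs i a (punchIn i j))
  oldKept j h with find (any⁻ _ (starPart ++ copyPart) h)
  ... | ρ , ρ∈ , ρj with origin ρ∈
  ...   | r , w , r∈rs , s , refl = touches⁺ (punchInᵢ≢i i j ∘ sym) (r , r∈rs , s ,
          subst (T ∘ is-just) (trans (lookup-++ˡ (removeAt r i) w j) (lookup-removeAt r i j)) ρj)

module _ (σ : Permutation′ c) where

  lookup-permCols : (r : Vec (Entry q) c) (t : Fin c) →
                    lookup (permCols σ r) t ≡ lookup r (σ ⟨$⟩ʳ t)
  lookup-permCols r t = lookup∘tabulate (lookup r ∘ (σ ⟨$⟩ʳ_)) t

  module _ {rs F : Rows q c} (rs↭ : rs ↭ L.map (permCols σ) F) {i : Fin c} {a : Fin q} where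

    covered-permute : ∀ {t} → Covered rs i a t → Covered F (σ ⟨$⟩ʳ i) a (σ ⟨$⟩ʳ t)
    covered-permute {t} (r , r∈rs , s , j) with ∈-map⁻ (permCols σ) (∈-resp-↭ rs↭ r∈rs)
    ... | r′ , r′∈F , refl = r′ , r′∈F ,
          subst (T ∘ survives a) (lookup-permCols r′ i) s ,
          subst (T ∘ is-just) (lookup-permCols r′ t) j

    touches-permute : ∀ t → T (touches rs i a t) → T (touches F (σ ⟨$⟩ʳ i) a (σ ⟨$⟩ʳ t))
    touches-permute t h with touches⁻ h
    ... | i≢t , cov = touches⁺ (i≢t ∘ Injection.injective (↔⇒↣ σ)) (covered-permute cov)

    occurrences-permute : occurrences rs i a ≡ occurrences F (σ ⟨$⟩ʳ i) a
    occurrences-permute = begin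
      occurrences rs i a
        ≡⟨ count-↭ _ rs↭ ⟩
      count (λ r → carries a (lookup r i)) (L.map (permCols σ) F)
        ≡⟨ count-map _ (permCols σ) F ⟩
      count (λ r → carries a (lookup (permCols σ r) i)) F
        ≡⟨ count-cong (λ r → cong (carries a) (lookup-permCols r i)) F ⟩
      occurrences F (σ ⟨$⟩ʳ i) a
        ∎
      where open ≡-Reasoning

    bangBound-permute : bangBound rs i a ≤ bangBound F (σ ⟨$⟩ʳ i) a
    bangBound-permute = +-mono-≤ card-touches (≤-reflexive occurrences-permute)
      where
      open ≤-Reasoning
      card-touches : card (touches rs i a) ≤ card (touches F (σ ⟨$⟩ʳ i) a)
      card-touches = begin
        card (touches rs i a)                      ≤⟨ card-mono _ _ touches-permute ⟩
        card (touches F (σ ⟨$⟩ʳ i) a ∘ (σ ⟨$⟩ʳ_))  ≡⟨ sum-permute _ σ ⟨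
        card (touches F (σ ⟨$⟩ʳ i) a)              ∎

-- fractal q (suc l) is definitionally concatMap (λ a → L.map (blockRow f a) S) (allFin q)
-- with f = fracCols q l and S = fractal q l.
blockRow : ∀ f → Fin q → Vec (Entry q) f → Vec (Entry q) (suc (q * f))
blockRow f a r =
  just a V.∷ V.concat (tabulate (λ b → if does (b ≟ a) then r else replicate f nothing))

groupCol : ∀ {f} → Fin q → Fin f → Fin (suc (q * f))
groupCol b p = suc (combine b p)

card-groupCol : ∀ {f} (p : Fin (suc (q * f)) → Bool) →
  card p ≡ indicator (p zero) + sum {q} (λ b → card (p ∘ groupCol b))
card-groupCol {q} p = cong (indicator (p zero) +_) (sum-combine q (indicator ∘ p ∘ suc))

module _ {f} (a : Fin q) (r : Vec (Entry q) f) where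

  private
    group : Bool → Vec (Entry q) f
    group own = if own then r else replicate f nothing

    lookup-blockRow : ∀ b p → lookup (blockRow f a r) (groupCol b p) ≡ lookup (group (does (b ≟ a))) p
    lookup-blockRow b p = trans (lookup-concat (tabulate (λ b → group (does (b ≟ a)))) b p)
      (cong (λ v → lookup v p) (lookup∘tabulate (λ b → group (does (b ≟ a))) b))

  lookup-blockRow-own : ∀ p → lookup (blockRow f a r) (groupCol a p) ≡ lookup r p
  lookup-blockRow-own p =
    trans (lookup-blockRow a p) (cong (λ own → lookup (group own) p) (dec-true (a ≟ a) refl))

  lookup-blockRow-other : ∀ {b} p → b ≢ a → lookup (blockRow f a r) (groupCol b p) ≡ nothing
  lookup-blockRow-other {b} p b≢a = trans (lookup-blockRow b p)
    (trans (cong (λ own → lookup (group own) p) (dec-false (b ≟ a) b≢a))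
           (lookup-replicate p nothing))

  blockRow-is-just⇒own-group : ∀ {b} p →
    T (is-just (lookup (blockRow f a r) (groupCol b p))) → b ≡ a
  blockRow-is-just⇒own-group {b} p j with b ≟ a
  ... | yes b≡a = b≡a
  ... | no b≢a  = ⊥-elim (subst (T ∘ is-just) (lookup-blockRow-other p b≢a) j)

fracCols-suc : ∀ q l → fracCols q (suc l) ≡ fracCols q l + q ^ l
fracCols-suc q zero    = cong suc (*-zeroʳ q)
fracCols-suc q (suc l) = cong suc (trans (cong (q *_) (fracCols-suc q l)) (*-distribˡ-+ q _ _))

length-fractal : ∀ q l → length (fractal q l) ≡ q ^ l
length-fractal q zero    = refl
length-fractal q (suc l) = begin
  length (fractal q (suc l))            ≡⟨ length-concatMap-tabulate block id ⟩
  sum {q} (λ a → length (block a))      ≡⟨ sum-cong-≗ (λ a → length-map (blockRow f a) S) ⟩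
  sum {q} (λ _ → length S)              ≡⟨ sum-const q _ ⟩
  q * length S                          ≡⟨ cong (q *_) (length-fractal q l) ⟩
  q * q ^ l                             ∎
  where
  open ≡-Reasoning
  f = fracCols q l
  S = fractal q l
  block = λ a → L.map (blockRow f a) S

module _ {q : ℕ} (l : ℕ) where

  private
    f  = fracCols q l
    S  = fractal q l
    F′ = fractal q (suc l)

  ∈-fractal⁻ : ∀ {ρ} → ρ ∈ F′ → ∃₂ λ a r → r ∈ S × ρ ≡ blockRow f a r
  ∈-fractal⁻ ρ∈ with find (∈-concatMap⁻ _ {xs = allFin q} ρ∈)
  ... | a , _ , ρ∈block with ∈-map⁻ _ ρ∈block
  ...   | r , r∈S , ρ≡ = a , r , r∈S , ρ≡

  covered-fractal⁻ : ∀ {i a t} → Covered F′ i a t → ∃₂ λ a′ r → r ∈ S ×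
    T (survives a (lookup (blockRow f a′ r) i)) × T (is-just (lookup (blockRow f a′ r) t))
  covered-fractal⁻ (ρ , ρ∈ , s , j) with ∈-fractal⁻ ρ∈
  ... | a′ , r , r∈S , refl = a′ , r , r∈S , s , j

  occurrences-fractal : ∀ i a →
    occurrences F′ i a ≡ sum {q} (λ a′ → count (λ r → carries a (lookup (blockRow f a′ r) i)) S)
  occurrences-fractal i a =
    trans (count-concatMap-tabulate _ (λ a′ → L.map (blockRow f a′) S) id)
          (sum-cong-≗ (λ a′ → count-map _ (blockRow f a′) S))

module _ {q′ : ℕ} (l : ℕ) where

  private
    f  = fracCols (suc q′) l
    S  = fractal (suc q′) l
    F′ = fractal (suc q′) (suc l)

  card-touches-head : (a : Fin (suc q′)) → card (touches F′ zero a) ≤ f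
  card-touches-head a = begin
    card (touches F′ zero a)
      ≡⟨ card-groupCol {suc q′} {f} (touches F′ zero a) ⟩
    sum {suc q′} (λ b → card (touches F′ zero a ∘ groupCol b))
      ≡⟨ sum-concentrated _ a (λ b b≢a → card-none _ (outside b≢a)) ⟩
    card (touches F′ zero a ∘ groupCol a)
      ≤⟨ card-≤ _ ⟩
    f
      ∎
    where
    open ≤-Reasoning
    outside : ∀ {b} → b ≢ a → ∀ p → ¬ T (touches F′ zero a (groupCol b p))
    outside {b} b≢a p h
      with covered-fractal⁻ l (proj₂ (touches⁻ {rs = F′} {zero} {groupCol b p} {a} h))
    ... | a′ , r , _ , s , j =
      b≢a (trans (blockRow-is-just⇒own-group a′ r {b = b} p j) (survives-just⇒≡ s))

  occurrences-head : (a : Fin (suc q′)) → occurrences F′ zero a ≤ length S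
  occurrences-head a = begin
    occurrences F′ zero a                                     ≡⟨ occurrences-fractal l zero a ⟩
    sum {suc q′} (λ a′ → count (λ _ → carries a (just a′)) S)
      ≡⟨ sum-concentrated _ a (λ a′ a′≢a → count-none (λ _ → dec-false (a′ ≟ a) a′≢a) S) ⟩
    count (λ _ → carries a (just a)) S                        ≤⟨ length-filter _ S ⟩
    length S                                                  ∎
    where open ≤-Reasoning

  module _ (b₀ : Fin (suc q′)) (p₀ : Fin f) (a : Fin (suc q′)) where

    private
      i = groupCol b₀ p₀

    card-touches-group : card (touches F′ i a) ≤ 1 + (card (touches S p₀ a) + q′ * f)
    card-touches-group = begin
      card (touches F′ i a)
        ≡⟨ card-groupCol {suc q′} {f} (touches F′ i a) ⟩
      indicator (touches F′ i a zero) + sum {suc q′} (card ∘ touched)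
        ≡⟨ cong (indicator (touches F′ i a zero) +_) (sum-remove {i = b₀} (card ∘ touched)) ⟩
      indicator (touches F′ i a zero) + (card (touched b₀) + sum (card ∘ touched ∘ punchIn b₀))
        ≤⟨ +-mono-≤ (indicator≤1 (touches F′ i a zero)) (+-mono-≤ (card-mono _ _ own) others) ⟩
      1 + (card (touches S p₀ a) + q′ * f)
        ∎
      where
      open ≤-Reasoning
      touched : Fin (suc q′) → Fin f → Bool
      touched b = touches F′ i a ∘ groupCol b
      others : sum (card ∘ touched ∘ punchIn b₀) ≤ q′ * f
      others = sum-≤-* (card ∘ touched ∘ punchIn b₀) (λ _ → card-≤ _)
      own : ∀ p → T (touched b₀ p) → T (touches S p₀ a p)
      own p h with touches⁻ h
      ... | i≢ , cov with covered-fractal⁻ l cov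
      ...   | a′ , r , r∈S , s , j with blockRow-is-just⇒own-group a′ r {b = b₀} p j
      ...     | refl = touches⁺ (i≢ ∘ cong (groupCol b₀)) (r , r∈S ,
                  subst (T ∘ survives a) (lookup-blockRow-own b₀ r p₀) s ,
                  subst (T ∘ is-just) (lookup-blockRow-own b₀ r p) j)

    occurrences-group : occurrences F′ i a ≡ occurrences S p₀ a
    occurrences-group = begin
      occurrences F′ i a
        ≡⟨ occurrences-fractal l i a ⟩
      sum {suc q′} (λ a′ → count (λ r → carries a (lookup (blockRow f a′ r) i)) S)
        ≡⟨ sum-concentrated _ b₀ (λ a′ a′≢b₀ →
             count-none (λ r → cong (carries a) (lookup-blockRow-other a′ r p₀ (a′≢b₀ ∘ sym))) S) ⟩
      count (λ r → carries a (lookup (blockRow f b₀ r) i)) S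
        ≡⟨ count-cong (λ r → cong (carries a) (lookup-blockRow-own b₀ r p₀)) S ⟩
      occurrences S p₀ a
        ∎
      where open ≡-Reasoning

bangBound-fractal : ∀ q l (i : Fin (fracCols q l)) (a : Fin q) →
                    bangBound (fractal q l) i a ≤ fracCols q l
bangBound-fractal q        zero    ()   a
bangBound-fractal zero     (suc l) i    ()
bangBound-fractal (suc q′) (suc l) zero a = begin
  bangBound (fractal (suc q′) (suc l)) zero a
    ≤⟨ +-mono-≤ (card-touches-head l a) (occurrences-head l a) ⟩
  fracCols (suc q′) l + length (fractal (suc q′) l)
    ≡⟨ cong (fracCols (suc q′) l +_) (length-fractal (suc q′) l) ⟩
  fracCols (suc q′) l + suc q′ ^ l
    ≡⟨ fracCols-suc (suc q′) l ⟨
  fracCols (suc q′) (suc l)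
    ∎
  where open ≤-Reasoning
bangBound-fractal (suc q′) (suc l) (suc u) a =
  subst (λ u → bangBound F′ (suc u) a ≤ fracCols (suc q′) (suc l)) (combine-remQuot f u) (begin
    bangBound F′ (groupCol b₀ p₀) a
      ≤⟨ +-mono-≤ (card-touches-group l b₀ p₀ a) (≤-reflexive (occurrences-group l b₀ p₀ a)) ⟩
    1 + (card (touches S p₀ a) + q′ * f) + occurrences S p₀ a
      ≡⟨ cong suc (xy∙z≈xz∙y (card (touches S p₀ a)) (q′ * f) (occurrences S p₀ a)) ⟩
    1 + (bangBound S p₀ a + q′ * f)
      ≤⟨ s≤s (+-monoˡ-≤ (q′ * f) (bangBound-fractal (suc q′) l p₀ a)) ⟩
    1 + (f + q′ * f)
      ∎)
  where
  open ≤-Reasoning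
  f  = fracCols (suc q′) l
  S  = fractal (suc q′) l
  F′ = fractal (suc q′) (suc l)
  b₀ = proj₁ (remQuot f u)
  p₀ = proj₂ (remQuot f u)

mainTheorem11 : (q m : ℕ) → 2 ≤ q → 1 ≤ m →
    (rs : Rows q (fracCols q m)) → PermutedFractal q m rs →
    ¬ Expandable {q} {fracCols q m} rs
mainTheorem11 q m _ _ rs (σ , rs↭) (i , a , expands) = <⇒≱ expands (begin
  bangCols rs i a                       ≤⟨ bangCols≤bangBound rs i a ⟩
  bangBound rs i a                      ≤⟨ bangBound-permute σ rs↭ ⟩
  bangBound (fractal q m) (σ ⟨$⟩ʳ i) a  ≤⟨ bangBound-fractal q m (σ ⟨$⟩ʳ i) a ⟩
  fracCols q m                          ∎)
  where open ≤-Reasoning
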